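{- Let $\mathcal{P}_1=(\mathcal{S}_1,\mathcal{F}_1,\mathrm{val})$ and $\mathcal{P}_2=(\mathcal{S}_2,\mathcal{F}_2,\mathrm{val})$ be optimization problems with guarantees $C_1,S_1$ and $C_2,S_2$, respectively. Suppose there is a reduction from $\mathcal{P}_1$ to $\mathcal{P}_2$ respecting these guarantees. Then \[ \mathrm{fc}(\mathcal{P}_1,C_1,S_1)\le\mathrm{fc}(\mathcal{P}_2,C_2,S_2) \qquad\text{and}\qquad \mathrm{fc}_+(\mathcal{P}_1,C_1,S_1)\le\mathrm{fc}_+(\mathcal{P}_2,C_2,S_2). \]
   Context: An optimization problem $\mathcal{P}=(\mathcal{S},\mathcal{F},\mathrm{val})$ consists of a set $\mathcal{S}$ of feasible solutions, a set $\mathcal{F}$ of instances and $\mathrm{val}\colon\mathcal{S}\times\mathcal{F}\to\mathbb{R}$, written $\mathrm{val}_f(s)$. It is a maximization or a minimization problem. Guarantees are real functions $C$ (completeness) and $S$ (soundness) on $\mathcal{F}$, with $C\ge S$ for maximization and $C\le S$ for minimization. Let $\mathcal{F}^{\mathcal{S}}=\{f:\max_s\mathrm{val}_f(s)\le S(f)\}$ for maximization and $\mathcal{F}^{\mathcal{S}}=\{f:\min_s\mathrm{val}_f(s)\ge S(f)\}$ for minimization. A $(C,S)$-approximate LP formulation of $\mathcal{P}$ consists of: - a system $Ax\le b$, $x\in\mathbb{R}^d$; - vectors $x^s$ ($s\in\mathcal{S}$) with $Ax^s\le b$; - affine $w^f\colon\mathbb{R}^d\to\mathbb{R}$ ($f\in\mathcal{F}^{\mathcal{S}}$)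 with $w^f(x^s)=\mathrm{val}_f(s)$; - the requirement $\max\{w^f(x):Ax\le b\}\le C(f)$ for all $f\in\mathcal{F}^{\mathcal{S}}$ (resp. $\min\ge C(f)$ for minimization). The size is the number of inequalities, and $\mathrm{fc}(\mathcal{P},C,S)$ is the minimum size. A $(C,S)$-approximate SDP formulation consists of: - a linear map $\mathcal{A}\colon\mathbb{S}^d\to\mathbb{R}^k$ and $b\in\mathbb{R}^k$; - matrices $X^s\in\mathbb{S}^d_+$ with $\mathcal{A}(X^s)=b$; - affine $w^f$ on $\mathbb{S}^d$ with $w^f(X^s)=\mathrm{val}_f(s)$; - the requirement $\sup\{w^f(X):X\in\mathbb{S}^d_+,\mathcal{A}(X)=b\}\le C(f)$ for $f\in\mathcal{F}^{\mathcal{S}}$ (inf $\ge$ for minimization). The size is $d$, and $\mathrm{fc}_+(\mathcal{P},C,S)$ is the minimum size. A reduction from $\mathcal{P}_1$ to $\mathcal{P}_2$ respecting the guarantees $C_1,S_1$ and $C_2,S_2$ consists of: - for every $f_1\in\mathcal{F}_1^{\mathcal{S}_1}$, nonnegative reals $b_{f_1,f}$ ($f\in\mathcal{F}_2^{\mathcal{S}_2}$, finitely many nonzero) and a real number $\mu(f_1)$ (the affine shift); - for every $s_1\in\mathcal{S}_1$, nonnegative reals $a_{s_1,s}$ ($s\in\mathcal{S}_2$, finitely many nonzero) with $\sum_{s}a_{s_1,s}=1$. Write $\varepsilon_i=+1$ if $\mathcal{P}_i$ is a maximization problem and $\varepsilon_i=-1$ if it is a minimization problem. These data are required to satisfy,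 for all $s_1\in\mathcal{S}_1$ and $f_1\in\mathcal{F}_1^{\mathcal{S}_1}$, \[ \mathrm{val}_{f_1}(s_1)=\mu(f_1)+\varepsilon_1\varepsilon_2\sum_{f\in\mathcal{F}_2^{\mathcal{S}_2},\,s\in\mathcal{S}_2}b_{f_1,f}\,a_{s_1,s}\,\mathrm{val}_f(s), \] \[ \varepsilon_1C_1(f_1)\ge\varepsilon_1\mu(f_1)+\varepsilon_2\sum_{f\in\mathcal{F}_2^{\mathcal{S}_2}}b_{f_1,f}\,C_2(f). \] For example, if both are maximization problems, the conditions read $\mathrm{val}_{f_1}(s_1)=\sum b_{f_1,f}a_{s_1,s}\mathrm{val}_f(s)+\mu(f_1)$ and $C_1(f_1)\ge\sum b_{f_1,f}C_2(f)+\mu(f_1)$. If $\mathcal{P}_1$ is maximization and $\mathcal{P}_2$ is minimization, they read $\mathrm{val}_{f_1}(s_1)=\mu(f_1)-\sum b_{f_1,f}a_{s_1,s}\mathrm{val}_f(s)$ and $C_1(f_1)\ge\mu(f_1)-\sum b_{f_1,f}C_2(f)$. -}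

module Defs where

open import Data.Nat using (ℕ; zero; suc)
open import Data.Fin using (Fin; zero; suc)
open import Data.List using (List; []; _∷_)
open import Data.Product using (Σ; _×_; _,_; ∃; proj₁)
open import Data.Sum using (_⊎_)
open import Relation.Binary.PropositionalEquality using (_≡_)
open import Relation.Nullary using (¬_)

-- The real numbers, axiomatised as a (Dedekind-)complete ordered field.
-- Any two models are isomorphic, so quantifying over all models is the
-- same as speaking about ℝ.

record CompleteOrderedField : Set₁ where
  infixl 6 _+_
  infixl 7 _*_
  infix 4 _≤_
  field
    Carrier : Set
    _+_ _*_ : Carrier → Carrier → Carrier
    -_      : Carrier → Carrier
    0# 1#   : Carrier
    _≤_     : Carrier → Carrier → Set
    +-assoc : ∀ x y z → (x + y) + z ≡ x + (y + z)
    +-comm  : ∀ x y → x + y ≡ y + x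
    +-identityˡ : ∀ x → 0# + x ≡ x
    -‿inverseˡ : ∀ x → (- x) + x ≡ 0#
    *-assoc : ∀ x y z → (x * y) * z ≡ x * (y * z)
    *-comm  : ∀ x y → x * y ≡ y * x
    *-identityˡ : ∀ x → 1# * x ≡ x
    distribˡ : ∀ x y z → x * (y + z) ≡ (x * y) + (x * z)
    0≢1 : ¬ (0# ≡ 1#)
    inverse : ∀ x → ¬ (x ≡ 0#) → Σ Carrier (λ y → y * x ≡ 1#)
    ≤-refl : ∀ x → x ≤ x
    ≤-antisym : ∀ {x y} → x ≤ y → y ≤ x → x ≡ y
    ≤-trans : ∀ {x y z} → x ≤ y → y ≤ z → x ≤ z
    ≤-total : ∀ x y → (x ≤ y) ⊎ (y ≤ x)
    +-mono-≤ : ∀ {x y} z → x ≤ y → x + z ≤ y + z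
    *-nonneg : ∀ {x y} → 0# ≤ x → 0# ≤ y → 0# ≤ x * y
    complete : (P : Carrier → Set) → Σ Carrier P →
               Σ Carrier (λ u → ∀ x → P x → x ≤ u) →
               Σ Carrier (λ s → (∀ x → P x → x ≤ s) ×
                                (∀ u → (∀ x → P x → x ≤ u) → s ≤ u))

data Sense : Set where
  maximize minimize : Sense

module Over (ℝ : CompleteOrderedField) where
  open CompleteOrderedField ℝ public renaming (Carrier to R)

  infix 4 _≥_
  _≥_ : R → R → Set
  x ≥ y = y ≤ x

  sgn : Sense → R
  sgn maximize = 1#
  sgn minimize = - 1#

  Σᶠ : (n : ℕ) → (Fin n → R) → R
  Σᶠ zero f = 0#
  Σᶠ (suc n) f = f zero + Σᶠ n (λ i → f (suc i))

  Σˡ : {A : Set} → List A → (A → R) → R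
  Σˡ [] f = 0#
  Σˡ (x ∷ xs) f = f x + Σˡ xs f

  Bounded : Sense → R → R → Set
  Bounded maximize v c = v ≤ c
  Bounded minimize v c = v ≥ c

  record Problem : Set₁ where
    field
      Sol   : Set
      Inst  : Set
      val   : Inst → Sol → R
      sense : Sense

  record Guarantees (P : Problem) : Set where
    open Problem P
    field
      C S : Inst → R
      C-vs-S : ∀ f → Bounded sense (S f) (C f)

  module _ {P : Problem} (G : Guarantees P) where
    open Problem P
    open Guarantees G

    InFS : Inst → Set
    InFS f = ∀ s → Bounded sense (val f s) (S f)

    record LPFormulation (m : ℕ) : Set₁ where
      field
        d : ℕ
        A : Fin m → Fin d → R
        b : Fin m → R
        xˢ : Sol → Fin d → R
        xˢ-feasible : ∀ s i → Σᶠ d (λ j → A i j * xˢ s j) ≤ b i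
        w₀ : (f : Inst) → InFS f → R
        wᶜ : (f : Inst) → InFS f → Fin d → R
        w-val : ∀ f (hf : InFS f) s →
                w₀ f hf + Σᶠ d (λ j → wᶜ f hf j * xˢ s j) ≡ val f s
        w-bound : ∀ f (hf : InFS f) (x : Fin d → R) →
                  (∀ i → Σᶠ d (λ j → A i j * x j) ≤ b i) →
                  Bounded sense (w₀ f hf + Σᶠ d (λ j → wᶜ f hf j * x j)) (C f)

    Mat : ℕ → Set
    Mat d = Fin d → Fin d → R

    Symmetric : ∀ {d} → Mat d → Set
    Symmetric X = ∀ i j → X i j ≡ X j i

    PSD : ∀ {d} → Mat d → Set
    PSD {d} X = Symmetric X ×
      (∀ (y : Fin d → R) → 0# ≤ Σᶠ d (λ i → Σᶠ d (λ j → y i * X i j * y j)))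

    ⟪_,_⟫ : ∀ {d} → Mat d → Mat d → R
    ⟪_,_⟫ {d} M X = Σᶠ d (λ i → Σᶠ d (λ j → M i j * X i j))

    -- (C,S)-approximate SDP formulation of size d.  A linear map
    -- 𝒜 : 𝕊^d → ℝ^k is given by matrices 𝒜ᵢ via 𝒜(X)ᵢ = ⟨𝒜ᵢ, X⟩, and an affine
    -- functional on 𝕊^d by w(X) = w₀ + ⟨W, X⟩.
    record SDPFormulation (d : ℕ) : Set₁ where
      field
        k : ℕ
        𝒜 : Fin k → Mat d
        b : Fin k → R
        Xˢ : Sol → Mat d
        Xˢ-psd : ∀ s → PSD (Xˢ s)
        Xˢ-feasible : ∀ s i → ⟪ 𝒜 i , Xˢ s ⟫ ≡ b i
        w₀ : (f : Inst) → InFS f → R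
        W : (f : Inst) → InFS f → Mat d
        w-val : ∀ f (hf : InFS f) s → w₀ f hf + ⟪ W f hf , Xˢ s ⟫ ≡ val f s
        w-bound : ∀ f (hf : InFS f) (X : Mat d) → PSD X →
                  (∀ i → ⟪ 𝒜 i , X ⟫ ≡ b i) →
                  Bounded sense (w₀ f hf + ⟪ W f hf , X ⟫) (C f)

  -- fc(P₁) ≤ fc(P₂): every formulation of P₂ of size m yields one of P₁
  -- of size at most m  (this also covers fc = ∞).
  open import Data.Nat using () renaming (_≤_ to _≤ℕ_)

  fc-≤ : {P₁ P₂ : Problem} → Guarantees P₁ → Guarantees P₂ → Set₁
  fc-≤ G₁ G₂ = ∀ m → LPFormulation G₂ m → Σ ℕ (λ m' → m' ≤ℕ m × LPFormulation G₁ m')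

  fc₊-≤ : {P₁ P₂ : Problem} → Guarantees P₁ → Guarantees P₂ → Set₁
  fc₊-≤ G₁ G₂ = ∀ d → SDPFormulation G₂ d → Σ ℕ (λ d' → d' ≤ℕ d × SDPFormulation G₁ d')

  record Reduction {P₁ P₂ : Problem} (G₁ : Guarantees P₁) (G₂ : Guarantees P₂) : Set where
    module P₁ = Problem P₁
    module P₂ = Problem P₂
    module G₁ = Guarantees G₁
    module G₂ = Guarantees G₂
    field
      -- finitely supported nonnegative weights b_{f₁,f} on f ∈ F₂^S
      bs : (f₁ : P₁.Inst) → InFS G₁ f₁ →
           List (Σ P₂.Inst (λ f → InFS G₂ f × Σ R (λ β → 0# ≤ β)))
      μ  : (f₁ : P₁.Inst) → InFS G₁ f₁ → R
      -- finitely supported nonnegative weights a_{s₁,s} summing to 1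
      as : P₁.Sol → List (P₂.Sol × Σ R (λ α → 0# ≤ α))
      as-sum : ∀ s₁ → Σˡ (as s₁) (λ p → proj₁ (Data.Product.proj₂ p)) ≡ 1#
      val-eq : ∀ s₁ f₁ (hf₁ : InFS G₁ f₁) →
        P₁.val f₁ s₁ ≡
          μ f₁ hf₁ + (sgn P₁.sense * sgn P₂.sense) *
            Σˡ (bs f₁ hf₁) (λ q → Σˡ (as s₁) (λ p →
              proj₁ (Data.Product.proj₂ (Data.Product.proj₂ q)) *
              proj₁ (Data.Product.proj₂ p) *
              P₂.val (proj₁ q) (proj₁ p)))
      C-ineq : ∀ f₁ (hf₁ : InFS G₁ f₁) →
        sgn P₁.sense * G₁.C f₁ ≥
          sgn P₁.sense * μ f₁ hf₁ + sgn P₂.sense *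
            Σˡ (bs f₁ hf₁) (λ q →
              proj₁ (Data.Product.proj₂ (Data.Product.proj₂ q)) * G₂.C (proj₁ q))

-- A reduction pulls formulations of P₂ back to formulations of P₁ of the same size: the
-- point of a solution s₁ is the a-weighted convex combination of the points of the s with
-- a_{s₁,s} > 0, so feasibility (linear inequalities, resp. linear equations together with
-- positive semidefiniteness) is preserved, and the functional of an instance f₁ is
-- μ(f₁) + ε₁ε₂ Σ_f b_{f₁,f} w^f, which is again affine. Bilinearity of the pairing gives
-- w^{f₁}(x^{s₁}) = val_{f₁}(s₁) from the first reduction identity, and since the b are
-- nonnegative, bounding every w^f by C₂(f) bounds w^{f₁} by C₁(f₁) via the second.
module Submission where

open import Defs
open import Data.Product using (Σ; _×_; _,_; proj₁; proj₂; curry; uncurry)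
open import Data.Nat using (ℕ; zero; suc)
open import Data.Nat.Properties using () renaming (≤-refl to ℕ-≤-refl)
open import Data.Fin using (Fin; zero; suc)
open import Data.List using (List; []; _∷_)
open import Relation.Binary.PropositionalEquality
  using (_≡_; refl; sym; trans; cong; cong₂; subst; subst₂; module ≡-Reasoning)

module _ (ℝ : CompleteOrderedField) where
  open Over ℝ
  open ≡-Reasoning

  +-identityʳ : ∀ x → x + 0# ≡ x
  +-identityʳ x = trans (+-comm x 0#) (+-identityˡ x)

  -‿inverseʳ : ∀ x → x + (- x) ≡ 0#
  -‿inverseʳ x = trans (+-comm x (- x)) (-‿inverseˡ x)

  *-identityʳ : ∀ x → x * 1# ≡ x
  *-identityʳ x = trans (*-comm x 1#) (*-identityˡ x)

  +-cancelˡ : ∀ a {b c} → a + b ≡ a + c → b ≡ c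
  +-cancelˡ a {b} {c} eq = begin
    b                ≡⟨ sym (+-identityˡ b) ⟩
    0# + b           ≡⟨ cong (_+ b) (sym (-‿inverseˡ a)) ⟩
    (- a + a) + b    ≡⟨ +-assoc (- a) a b ⟩
    - a + (a + b)    ≡⟨ cong (- a +_) eq ⟩
    - a + (a + c)    ≡⟨ sym (+-assoc (- a) a c) ⟩
    (- a + a) + c    ≡⟨ cong (_+ c) (-‿inverseˡ a) ⟩
    0# + c           ≡⟨ +-identityˡ c ⟩
    c                ∎

  *-zeroʳ : ∀ x → x * 0# ≡ 0#
  *-zeroʳ x = +-cancelˡ (x * 0#) (begin
    x * 0# + x * 0#  ≡⟨ sym (distribˡ x 0# 0#) ⟩
    x * (0# + 0#)    ≡⟨ cong (x *_) (+-identityˡ 0#) ⟩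
    x * 0#           ≡⟨ sym (+-identityʳ _) ⟩
    x * 0# + 0#      ∎)

  -‿inverseʳ-unique : ∀ a b → a + b ≡ 0# → b ≡ - a
  -‿inverseʳ-unique a b eq = +-cancelˡ a (trans eq (sym (-‿inverseʳ a)))

  neg-distribʳ-* : ∀ x y → - (x * y) ≡ x * (- y)
  neg-distribʳ-* x y = sym (-‿inverseʳ-unique (x * y) (x * (- y)) (begin
    x * y + x * (- y)  ≡⟨ sym (distribˡ x y (- y)) ⟩
    x * (y + (- y))    ≡⟨ cong (x *_) (-‿inverseʳ y) ⟩
    x * 0#             ≡⟨ *-zeroʳ x ⟩
    0#                 ∎))

  -1*x≡-x : ∀ x → (- 1#) * x ≡ - x
  -1*x≡-x x = begin
    (- 1#) * x   ≡⟨ *-comm (- 1#) x ⟩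
    x * (- 1#)   ≡⟨ sym (neg-distribʳ-* x 1#) ⟩
    - (x * 1#)   ≡⟨ cong -_ (*-identityʳ x) ⟩
    - x          ∎

  neg-involutive : ∀ x → - (- x) ≡ x
  neg-involutive x = sym (-‿inverseʳ-unique (- x) x (-‿inverseˡ x))

  sgn*sgn≡1 : ∀ s → sgn s * sgn s ≡ 1#
  sgn*sgn≡1 maximize = *-identityˡ 1#
  sgn*sgn≡1 minimize = trans (-1*x≡-x (- 1#)) (neg-involutive 1#)

  x*yz≡y*xz : ∀ x y z → x * (y * z) ≡ y * (x * z)
  x*yz≡y*xz x y z = begin
    x * (y * z)  ≡⟨ sym (*-assoc x y z) ⟩
    (x * y) * z  ≡⟨ cong (_* z) (*-comm x y) ⟩
    (y * x) * z  ≡⟨ *-assoc y x z ⟩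
    y * (x * z)  ∎

  +-interchange : ∀ a b c d → (a + b) + (c + d) ≡ (a + c) + (b + d)
  +-interchange a b c d = begin
    (a + b) + (c + d)  ≡⟨ +-assoc a b (c + d) ⟩
    a + (b + (c + d))  ≡⟨ cong (a +_) (sym (+-assoc b c d)) ⟩
    a + ((b + c) + d)  ≡⟨ cong (λ z → a + (z + d)) (+-comm b c) ⟩
    a + ((c + b) + d)  ≡⟨ cong (a +_) (+-assoc c b d) ⟩
    a + (c + (b + d))  ≡⟨ sym (+-assoc a c (b + d)) ⟩
    (a + c) + (b + d)  ∎

  +-monoʳ-≤ : ∀ {x y} z → x ≤ y → z + x ≤ z + y
  +-monoʳ-≤ {x} {y} z p = subst₂ _≤_ (+-comm x z) (+-comm y z) (+-mono-≤ z p)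

  +-mono₂-≤ : ∀ {a b c d} → a ≤ b → c ≤ d → a + c ≤ b + d
  +-mono₂-≤ {b = b} {c} p q = ≤-trans (+-mono-≤ c p) (+-monoʳ-≤ b q)

  x≤y⇒0≤y-x : ∀ {x y} → x ≤ y → 0# ≤ y + (- x)
  x≤y⇒0≤y-x {x} {y} p = subst (_≤ y + (- x)) (-‿inverseʳ x) (+-mono-≤ (- x) p)

  neg-antimono-≤ : ∀ {x y} → x ≤ y → - y ≤ - x
  neg-antimono-≤ {x} {y} p = subst₂ _≤_ (+-identityˡ (- y)) lhs (+-mono-≤ (- y) (x≤y⇒0≤y-x p))
    where
    lhs : y + (- x) + (- y) ≡ - x
    lhs = begin
      y + (- x) + (- y)    ≡⟨ cong (_+ (- y)) (+-comm y (- x)) ⟩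
      (- x) + y + (- y)    ≡⟨ +-assoc (- x) y (- y) ⟩
      (- x) + (y + (- y))  ≡⟨ cong ((- x) +_) (-‿inverseʳ y) ⟩
      (- x) + 0#           ≡⟨ +-identityʳ (- x) ⟩
      - x                  ∎

  *-monoʳ-≤-nonNeg : ∀ {c x y} → 0# ≤ c → x ≤ y → c * x ≤ c * y
  *-monoʳ-≤-nonNeg {c} {x} {y} 0≤c p =
    subst₂ _≤_ (+-identityˡ (c * x)) c[y-x]+cx≡cy (+-mono-≤ (c * x) (*-nonneg 0≤c (x≤y⇒0≤y-x p)))
    where
    c[y-x]+cx≡cy : c * (y + (- x)) + c * x ≡ c * y
    c[y-x]+cx≡cy = begin
      c * (y + (- x)) + c * x          ≡⟨ cong (_+ c * x) (distribˡ c y (- x)) ⟩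
      c * y + c * (- x) + c * x        ≡⟨ cong (λ z → c * y + z + c * x) (sym (neg-distribʳ-* c x)) ⟩
      c * y + - (c * x) + c * x        ≡⟨ +-assoc (c * y) _ (c * x) ⟩
      c * y + (- (c * x) + c * x)      ≡⟨ cong (c * y +_) (-‿inverseˡ (c * x)) ⟩
      c * y + 0#                       ≡⟨ +-identityʳ (c * y) ⟩
      c * y                            ∎

  Bounded⇒sgn-≤ : ∀ s {v c} → Bounded s v c → sgn s * v ≤ sgn s * c
  Bounded⇒sgn-≤ maximize p = subst₂ _≤_ (sym (*-identityˡ _)) (sym (*-identityˡ _)) p
  Bounded⇒sgn-≤ minimize p = subst₂ _≤_ (sym (-1*x≡-x _)) (sym (-1*x≡-x _)) (neg-antimono-≤ p)

  sgn-≤⇒Bounded : ∀ s {v c} → sgn s * v ≤ sgn s * c → Bounded s v c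
  sgn-≤⇒Bounded maximize p = subst₂ _≤_ (*-identityˡ _) (*-identityˡ _) p
  sgn-≤⇒Bounded minimize p =
    subst₂ _≤_ (neg-involutive _) (neg-involutive _) (neg-antimono-≤ (subst₂ _≤_ (-1*x≡-x _) (-1*x≡-x _) p))

  module _ {A : Set} where

    Σˡ-cong : (L : List A) {f g : A → R} → (∀ a → f a ≡ g a) → Σˡ L f ≡ Σˡ L g
    Σˡ-cong []      h = refl
    Σˡ-cong (a ∷ L) h = cong₂ _+_ (h a) (Σˡ-cong L h)

    Σˡ-+ : (L : List A) (f g : A → R) → Σˡ L (λ a → f a + g a) ≡ Σˡ L f + Σˡ L g
    Σˡ-+ []      f g = sym (+-identityˡ 0#)
    Σˡ-+ (a ∷ L) f g = trans (cong (f a + g a +_) (Σˡ-+ L f g)) (+-interchange _ _ _ _)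

    Σˡ-0 : (L : List A) → Σˡ L (λ _ → 0#) ≡ 0#
    Σˡ-0 []      = refl
    Σˡ-0 (a ∷ L) = trans (cong (0# +_) (Σˡ-0 L)) (+-identityˡ 0#)

    *-Σˡ : (L : List A) (c : R) (f : A → R) → c * Σˡ L f ≡ Σˡ L (λ a → c * f a)
    *-Σˡ []      c f = *-zeroʳ c
    *-Σˡ (a ∷ L) c f = trans (distribˡ c _ _) (cong (c * f a +_) (*-Σˡ L c f))

    *-Σˡ-weighted : (L : List A) (α u : A → R) (c : R) →
                    c * Σˡ L (λ a → α a * u a) ≡ Σˡ L (λ a → α a * (c * u a))
    *-Σˡ-weighted L α u c = trans (*-Σˡ L c _) (Σˡ-cong L (λ a → x*yz≡y*xz c (α a) (u a)))

    Σˡ-weighted-* : (L : List A) (α u : A → R) (c : R) →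
                    Σˡ L (λ a → α a * u a) * c ≡ Σˡ L (λ a → α a * (u a * c))
    Σˡ-weighted-* L α u c = begin
      Σˡ L (λ a → α a * u a) * c    ≡⟨ *-comm _ c ⟩
      c * Σˡ L (λ a → α a * u a)    ≡⟨ *-Σˡ-weighted L α u c ⟩
      Σˡ L (λ a → α a * (c * u a))  ≡⟨ Σˡ-cong L (λ a → cong (α a *_) (*-comm c (u a))) ⟩
      Σˡ L (λ a → α a * (u a * c))  ∎

    Σˡ-weighted-+ : (L : List A) (α u v : A → R) →
                    Σˡ L (λ a → α a * u a) + Σˡ L (λ a → α a * v a) ≡ Σˡ L (λ a → α a * (u a + v a))
    Σˡ-weighted-+ L α u v =
      trans (sym (Σˡ-+ L _ _)) (Σˡ-cong L (λ a → sym (distribˡ (α a) (u a) (v a))))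

    Σˡ-weighted-mono-≤ : (L : List A) {α u v : A → R} → (∀ a → 0# ≤ α a) → (∀ a → u a ≤ v a) →
                         Σˡ L (λ a → α a * u a) ≤ Σˡ L (λ a → α a * v a)
    Σˡ-weighted-mono-≤ []      α≥0 u≤v = ≤-refl 0#
    Σˡ-weighted-mono-≤ (a ∷ L) α≥0 u≤v =
      +-mono₂-≤ (*-monoʳ-≤-nonNeg (α≥0 a) (u≤v a)) (Σˡ-weighted-mono-≤ L α≥0 u≤v)

    Σˡ-weighted-nonneg : (L : List A) {α u : A → R} → (∀ a → 0# ≤ α a) → (∀ a → 0# ≤ u a) →
                         0# ≤ Σˡ L (λ a → α a * u a)
    Σˡ-weighted-nonneg L {α} {u} α≥0 u≥0 =
      subst (_≤ Σˡ L (λ a → α a * u a)) (trans (Σˡ-cong L (λ a → *-zeroʳ (α a))) (Σˡ-0 L)) (Σˡ-weighted-mono-≤ L α≥0 u≥0)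

    Σˡ-convex-const : (L : List A) (α : A → R) → Σˡ L α ≡ 1# → (c : R) → Σˡ L (λ a → α a * c) ≡ c
    Σˡ-convex-const L α Σα≡1 c = begin
      Σˡ L (λ a → α a * c)  ≡⟨ Σˡ-cong L (λ a → *-comm (α a) c) ⟩
      Σˡ L (λ a → c * α a)  ≡⟨ sym (*-Σˡ L c α) ⟩
      c * Σˡ L α            ≡⟨ cong (c *_) Σα≡1 ⟩
      c * 1#                ≡⟨ *-identityʳ c ⟩
      c                     ∎

  record Summation : Set₁ where
    field
      Ix    : Set
      ∑     : (Ix → R) → R
      ∑-cong : ∀ {f g} → (∀ i → f i ≡ g i) → ∑ f ≡ ∑ g
      ∑-+   : ∀ f g → ∑ (λ i → f i + g i) ≡ ∑ f + ∑ g
      ∑-0   : ∑ (λ _ → 0#) ≡ 0#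
      *-∑   : ∀ c f → c * ∑ f ≡ ∑ (λ i → c * f i)

    Vector : Set
    Vector = Ix → R

    ⟨_,_⟩ : Vector → Vector → R
    ⟨ c , x ⟩ = ∑ (λ i → c i * x i)

    module _ {A : Set} where

      lincomb : List A → (A → R) → (A → Vector) → Vector
      lincomb L α v i = Σˡ L (λ a → α a * v a i)

      ∑-Σˡ : (L : List A) (g : Ix → A → R) → ∑ (λ i → Σˡ L (g i)) ≡ Σˡ L (λ a → ∑ (λ i → g i a))
      ∑-Σˡ []      g = ∑-0
      ∑-Σˡ (a ∷ L) g = trans (∑-+ _ _) (cong (∑ (λ i → g i a) +_) (∑-Σˡ L g))

      ∑-lincomb : (L : List A) (α : A → R) (v : A → Vector) →
                  ∑ (lincomb L α v) ≡ Σˡ L (λ a → α a * ∑ (v a))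
      ∑-lincomb L α v = trans (∑-Σˡ L (λ i a → α a * v a i)) (Σˡ-cong L (λ a → sym (*-∑ (α a) (v a))))

      ⟨⟩-lincombʳ : (c : Vector) (L : List A) (α : A → R) (v : A → Vector) →
                    ⟨ c , lincomb L α v ⟩ ≡ Σˡ L (λ a → α a * ⟨ c , v a ⟩)
      ⟨⟩-lincombʳ c L α v = trans (∑-cong (λ i → *-Σˡ-weighted L α (λ a → v a i) (c i)))
                                  (∑-lincomb L α (λ a i → c i * v a i))

      ⟨⟩-lincombˡ : (L : List A) (α : A → R) (v : A → Vector) (x : Vector) →
                    ⟨ lincomb L α v , x ⟩ ≡ Σˡ L (λ a → α a * ⟨ v a , x ⟩)
      ⟨⟩-lincombˡ L α v x = trans (∑-cong (λ i → Σˡ-weighted-* L α (λ a → v a i) (x i)))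
                                  (∑-lincomb L α (λ a i → v a i * x i))

    ⟨⟩-scaleˡ : (c : R) (v x : Vector) → ⟨ (λ i → c * v i) , x ⟩ ≡ c * ⟨ v , x ⟩
    ⟨⟩-scaleˡ c v x = trans (∑-cong (λ i → *-assoc c (v i) (x i))) (sym (*-∑ c _))

  Fin-summation : ℕ → Summation
  Fin-summation n = record
    { Ix = Fin n ; ∑ = Σᶠ n ; ∑-cong = Σᶠ-cong n ; ∑-+ = Σᶠ-+ n ; ∑-0 = Σᶠ-0 n ; *-∑ = *-Σᶠ n }
    where
    Σᶠ-cong : ∀ n {f g : Fin n → R} → (∀ i → f i ≡ g i) → Σᶠ n f ≡ Σᶠ n g
    Σᶠ-cong zero    h = refl
    Σᶠ-cong (suc n) h = cong₂ _+_ (h zero) (Σᶠ-cong n (λ i → h (suc i)))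

    Σᶠ-+ : ∀ n (f g : Fin n → R) → Σᶠ n (λ i → f i + g i) ≡ Σᶠ n f + Σᶠ n g
    Σᶠ-+ zero    f g = sym (+-identityˡ 0#)
    Σᶠ-+ (suc n) f g =
      trans (cong (f zero + g zero +_) (Σᶠ-+ n (λ i → f (suc i)) (λ i → g (suc i)))) (+-interchange _ _ _ _)

    Σᶠ-0 : ∀ n → Σᶠ n (λ _ → 0#) ≡ 0#
    Σᶠ-0 zero    = refl
    Σᶠ-0 (suc n) = trans (cong (0# +_) (Σᶠ-0 n)) (+-identityˡ 0#)

    *-Σᶠ : ∀ n c (f : Fin n → R) → c * Σᶠ n f ≡ Σᶠ n (λ i → c * f i)
    *-Σᶠ zero    c f = *-zeroʳ c
    *-Σᶠ (suc n) c f = trans (distribˡ c _ _) (cong (c * f zero +_) (*-Σᶠ n c (λ i → f (suc i))))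

  _⊗_ : Summation → Summation → Summation
  K ⊗ L = record
    { Ix = K.Ix × L.Ix
    ; ∑ = λ f → K.∑ (λ i → L.∑ (λ j → f (i , j)))
    ; ∑-cong = λ h → K.∑-cong (λ i → L.∑-cong (λ j → h (i , j)))
    ; ∑-+ = λ f g → trans (K.∑-cong (λ i → L.∑-+ _ _)) (K.∑-+ _ _)
    ; ∑-0 = trans (K.∑-cong (λ _ → L.∑-0)) K.∑-0
    ; *-∑ = λ c f → trans (K.*-∑ c _) (K.∑-cong (λ i → L.*-∑ c _))
    }
    where
    module K = Summation K
    module L = Summation L

  PSD-lincomb : {P : Problem} (G : Guarantees P) {A : Set} {d : ℕ} (L : List A) {α : A → R}
                {X : A → Mat G d} → (∀ a → 0# ≤ α a) → (∀ a → PSD G (X a)) →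
                PSD G (λ i j → Σˡ L (λ a → α a * X a i j))
  PSD-lincomb G {d = d} L {α} {X} α≥0 X-psd = symmetric , nonneg
    where
    open Summation (Fin-summation d ⊗ Fin-summation d) using (∑; ∑-cong; ∑-lincomb)

    Xᴸ : Mat G d
    Xᴸ i j = Σˡ L (λ a → α a * X a i j)

    quadratic-form : Mat G d → (Fin d → R) → Fin d × Fin d → R
    quadratic-form Y y (i , j) = y i * Y i j * y j

    symmetric : Symmetric G Xᴸ
    symmetric i j = Σˡ-cong L (λ a → cong (α a *_) (proj₁ (X-psd a) i j))

    pointwise : ∀ y ij → quadratic-form Xᴸ y ij ≡ Σˡ L (λ a → α a * quadratic-form (X a) y ij)
    pointwise y (i , j) = trans (cong (_* y j) (*-Σˡ-weighted L α (λ a → X a i j) (y i)))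
                                (Σˡ-weighted-* L α (λ a → y i * X a i j) (y j))

    nonneg : ∀ y → 0# ≤ ∑ (quadratic-form Xᴸ y)
    nonneg y = subst (0# ≤_) (sym (trans (∑-cong (pointwise y)) (∑-lincomb L α (λ a → quadratic-form (X a) y))))
                 (Σˡ-weighted-nonneg L α≥0 (λ a → proj₂ (X-psd a) y))

  sgn-cancelˡ : ∀ s t x → sgn s * ((sgn s * sgn t) * x) ≡ sgn t * x
  sgn-cancelˡ s t x = begin
    sgn s * ((sgn s * sgn t) * x)  ≡⟨ sym (*-assoc (sgn s) _ x) ⟩
    (sgn s * (sgn s * sgn t)) * x  ≡⟨ cong (_* x) (sym (*-assoc (sgn s) (sgn s) (sgn t))) ⟩
    (sgn s * sgn s * sgn t) * x    ≡⟨ cong (λ z → z * sgn t * x) (sgn*sgn≡1 s) ⟩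
    (1# * sgn t) * x               ≡⟨ cong (_* x) (*-identityˡ (sgn t)) ⟩
    sgn t * x                      ∎

  module Pullback {P₁ P₂ : Problem} {G₁ : Guarantees P₁} {G₂ : Guarantees P₂}
                  (red : Reduction G₁ G₂) where
    open Reduction red

    WeightedInstance : Set
    WeightedInstance = Σ P₂.Inst (λ f → InFS G₂ f × Σ R (λ β → 0# ≤ β))

    WeightedSolution : Set
    WeightedSolution = P₂.Sol × Σ R (λ α → 0# ≤ α)

    inst : WeightedInstance → P₂.Inst
    inst = proj₁

    inst-FS : (q : WeightedInstance) → InFS G₂ (inst q)
    inst-FS q = proj₁ (proj₂ q)

    β : WeightedInstance → R
    β q = proj₁ (proj₂ (proj₂ q))

    β≥0 : ∀ q → 0# ≤ β q
    β≥0 q = proj₂ (proj₂ (proj₂ q))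

    sol : WeightedSolution → P₂.Sol
    sol = proj₁

    α : WeightedSolution → R
    α p = proj₁ (proj₂ p)

    α≥0 : ∀ p → 0# ≤ α p
    α≥0 p = proj₂ (proj₂ p)

    ε : R
    ε = sgn P₁.sense * sgn P₂.sense

    val≡combination : ∀ s₁ f₁ (hf₁ : InFS G₁ f₁) (V : WeightedInstance → R) →
      (∀ q → V q ≡ Σˡ (as s₁) (λ p → α p * P₂.val (inst q) (sol p))) →
      μ f₁ hf₁ + ε * Σˡ (bs f₁ hf₁) (λ q → β q * V q) ≡ P₁.val f₁ s₁
    val≡combination s₁ f₁ hf₁ V V≡ =
      trans (cong (λ z → μ f₁ hf₁ + ε * z) (Σˡ-cong (bs f₁ hf₁) βV≡)) (sym (val-eq s₁ f₁ hf₁))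
      where
      βV≡ : ∀ q → β q * V q ≡ Σˡ (as s₁) (λ p → β q * α p * P₂.val (inst q) (sol p))
      βV≡ q = begin
        β q * V q                                             ≡⟨ cong (β q *_) (V≡ q) ⟩
        β q * Σˡ (as s₁) (λ p → α p * P₂.val (inst q) (sol p)) ≡⟨ *-Σˡ (as s₁) (β q) _ ⟩
        Σˡ (as s₁) (λ p → β q * (α p * P₂.val (inst q) (sol p)))
          ≡⟨ Σˡ-cong (as s₁) (λ p → sym (*-assoc (β q) (α p) _)) ⟩
        Σˡ (as s₁) (λ p → β q * α p * P₂.val (inst q) (sol p)) ∎

    combination-Bounded : ∀ f₁ (hf₁ : InFS G₁ f₁) (V : WeightedInstance → R) →
      (∀ q → Bounded P₂.sense (V q) (G₂.C (inst q))) →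
      Bounded P₁.sense (μ f₁ hf₁ + ε * Σˡ (bs f₁ hf₁) (λ q → β q * V q)) (G₁.C f₁)
    combination-Bounded f₁ hf₁ V V-bounded =
      sgn-≤⇒Bounded P₁.sense (≤-trans (subst (_≤ bound) (sym split) (+-monoʳ-≤ ε₁μ ε₂V≤ε₂C)) (C-ineq f₁ hf₁))
      where
      L = bs f₁ hf₁
      ε₁μ = sgn P₁.sense * μ f₁ hf₁
      bound = ε₁μ + sgn P₂.sense * Σˡ L (λ q → β q * G₂.C (inst q))
      split : sgn P₁.sense * (μ f₁ hf₁ + ε * Σˡ L (λ q → β q * V q))
              ≡ sgn P₁.sense * μ f₁ hf₁ + sgn P₂.sense * Σˡ L (λ q → β q * V q)
      split = trans (distribˡ _ _ _) (cong (ε₁μ +_) (sgn-cancelˡ P₁.sense P₂.sense _))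
      ε₂V≤ε₂C : sgn P₂.sense * Σˡ L (λ q → β q * V q) ≤ sgn P₂.sense * Σˡ L (λ q → β q * G₂.C (inst q))
      ε₂V≤ε₂C = subst₂ _≤_ (sym (*-Σˡ-weighted L β V _)) (sym (*-Σˡ-weighted L β _ _))
                  (Σˡ-weighted-mono-≤ L β≥0 (λ q → Bounded⇒sgn-≤ P₂.sense (V-bounded q)))

    pullback-offset : ((f : P₂.Inst) → InFS G₂ f → R) → (f₁ : P₁.Inst) → InFS G₁ f₁ → R
    pullback-offset w₀ f₁ hf₁ = μ f₁ hf₁ + ε * Σˡ (bs f₁ hf₁) (λ q → β q * w₀ (inst q) (inst-FS q))

    module _ (K : Summation) where
      open Summation K

      pullback-point : (P₂.Sol → Vector) → P₁.Sol → Vector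
      pullback-point x s₁ = lincomb (as s₁) α (λ p → x (sol p))

      pullback-gradient : ((f : P₂.Inst) → InFS G₂ f → Vector) → (f₁ : P₁.Inst) → InFS G₁ f₁ → Vector
      pullback-gradient w f₁ hf₁ i = ε * lincomb (bs f₁ hf₁) β (λ q → w (inst q) (inst-FS q)) i

      pullback-point-≤ : ∀ {c r x} → (∀ s → ⟨ c , x s ⟩ ≤ r) → ∀ s₁ → ⟨ c , pullback-point x s₁ ⟩ ≤ r
      pullback-point-≤ {c} {r} {x} x-feasible s₁ =
        subst₂ _≤_ (sym (⟨⟩-lincombʳ c (as s₁) α _)) (Σˡ-convex-const (as s₁) α (as-sum s₁) r)
          (Σˡ-weighted-mono-≤ (as s₁) α≥0 (λ p → x-feasible (sol p)))

      pullback-point-≡ : ∀ {c r x} → (∀ s → ⟨ c , x s ⟩ ≡ r) → ∀ s₁ → ⟨ c , pullback-point x s₁ ⟩ ≡ r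
      pullback-point-≡ {c} {r} {x} x-feasible s₁ = begin
        ⟨ c , pullback-point x s₁ ⟩           ≡⟨ ⟨⟩-lincombʳ c (as s₁) α _ ⟩
        Σˡ (as s₁) (λ p → α p * ⟨ c , x (sol p) ⟩) ≡⟨ Σˡ-cong (as s₁) (λ p → cong (α p *_) (x-feasible (sol p))) ⟩
        Σˡ (as s₁) (λ p → α p * r)            ≡⟨ Σˡ-convex-const (as s₁) α (as-sum s₁) r ⟩
        r                                     ∎

      module _ (w₀ : (f : P₂.Inst) → InFS G₂ f → R) (w : (f : P₂.Inst) → InFS G₂ f → Vector) where

        pullback-eval : ∀ f₁ hf₁ x →
          pullback-offset w₀ f₁ hf₁ + ⟨ pullback-gradient w f₁ hf₁ , x ⟩
          ≡ μ f₁ hf₁ + ε * Σˡ (bs f₁ hf₁) (λ q → β q * (w₀ (inst q) (inst-FS q) + ⟨ w (inst q) (inst-FS q) , x ⟩))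
        pullback-eval f₁ hf₁ x = begin
          (μ₁ + ε * Σˡ L (λ q → β q * w₀ᵠ q)) + ⟨ pullback-gradient w f₁ hf₁ , x ⟩
            ≡⟨ cong (μ₁ + ε * Σˡ L (λ q → β q * w₀ᵠ q) +_) (trans (⟨⟩-scaleˡ ε _ x) (cong (ε *_) (⟨⟩-lincombˡ L β wᵠ x))) ⟩
          (μ₁ + ε * Σˡ L (λ q → β q * w₀ᵠ q)) + ε * Σˡ L (λ q → β q * ⟨ wᵠ q , x ⟩)
            ≡⟨ +-assoc μ₁ _ _ ⟩
          μ₁ + (ε * Σˡ L (λ q → β q * w₀ᵠ q) + ε * Σˡ L (λ q → β q * ⟨ wᵠ q , x ⟩))
            ≡⟨ cong (μ₁ +_) (sym (distribˡ ε _ _)) ⟩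
          μ₁ + ε * (Σˡ L (λ q → β q * w₀ᵠ q) + Σˡ L (λ q → β q * ⟨ wᵠ q , x ⟩))
            ≡⟨ cong (λ z → μ₁ + ε * z) (Σˡ-weighted-+ L β _ _) ⟩
          μ₁ + ε * Σˡ L (λ q → β q * (w₀ᵠ q + ⟨ wᵠ q , x ⟩)) ∎
          where
          μ₁ = μ f₁ hf₁
          L = bs f₁ hf₁
          w₀ᵠ : WeightedInstance → R
          w₀ᵠ q = w₀ (inst q) (inst-FS q)
          wᵠ : WeightedInstance → Vector
          wᵠ q = w (inst q) (inst-FS q)

        pullback-val : ∀ {x} → (∀ f hf s → w₀ f hf + ⟨ w f hf , x s ⟩ ≡ P₂.val f s) →
          ∀ f₁ hf₁ s₁ → pullback-offset w₀ f₁ hf₁ + ⟨ pullback-gradient w f₁ hf₁ , pullback-point x s₁ ⟩ ≡ P₁.val f₁ s₁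
        pullback-val {x} w-val f₁ hf₁ s₁ = trans (pullback-eval f₁ hf₁ _) (val≡combination s₁ f₁ hf₁ _ value)
          where
          value : ∀ q → w₀ (inst q) (inst-FS q) + ⟨ w (inst q) (inst-FS q) , pullback-point x s₁ ⟩
                        ≡ Σˡ (as s₁) (λ p → α p * P₂.val (inst q) (sol p))
          value (f , hf , _) = begin
            w₀ f hf + ⟨ w f hf , pullback-point x s₁ ⟩
              ≡⟨ cong (w₀ f hf +_) (⟨⟩-lincombʳ (w f hf) (as s₁) α _) ⟩
            w₀ f hf + Σˡ (as s₁) (λ p → α p * ⟨ w f hf , x (sol p) ⟩)
              ≡⟨ cong (_+ _) (sym (Σˡ-convex-const (as s₁) α (as-sum s₁) (w₀ f hf))) ⟩
            Σˡ (as s₁) (λ p → α p * w₀ f hf) + Σˡ (as s₁) (λ p → α p * ⟨ w f hf , x (sol p) ⟩)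
              ≡⟨ Σˡ-weighted-+ (as s₁) α _ _ ⟩
            Σˡ (as s₁) (λ p → α p * (w₀ f hf + ⟨ w f hf , x (sol p) ⟩))
              ≡⟨ Σˡ-cong (as s₁) (λ p → cong (α p *_) (w-val f hf (sol p))) ⟩
            Σˡ (as s₁) (λ p → α p * P₂.val f (sol p)) ∎

        pullback-Bounded : ∀ {x} → (∀ f hf → Bounded P₂.sense (w₀ f hf + ⟨ w f hf , x ⟩) (G₂.C f)) →
          ∀ f₁ hf₁ → Bounded P₁.sense (pullback-offset w₀ f₁ hf₁ + ⟨ pullback-gradient w f₁ hf₁ , x ⟩) (G₁.C f₁)
        pullback-Bounded {x} w-bound f₁ hf₁ =
          subst (λ v → Bounded P₁.sense v (G₁.C f₁)) (sym (pullback-eval f₁ hf₁ x))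
            (combination-Bounded f₁ hf₁ _ (λ q → w-bound (inst q) (inst-FS q)))

    pullback-LP : ∀ {m} → LPFormulation G₂ m → LPFormulation G₁ m
    pullback-LP F = record
      { d = d
      ; A = A
      ; b = b
      ; xˢ = pullback-point K xˢ
      ; xˢ-feasible = λ s₁ i → pullback-point-≤ K (λ s → xˢ-feasible s i) s₁
      ; w₀ = pullback-offset w₀
      ; wᶜ = pullback-gradient K wᶜ
      ; w-val = pullback-val K w₀ wᶜ w-val
      ; w-bound = λ f₁ hf₁ x x-feasible → pullback-Bounded K w₀ wᶜ (λ f hf → w-bound f hf x x-feasible) f₁ hf₁
      }
      where
      open LPFormulation F
      K = Fin-summation d

    -- A d × d matrix is a vector indexed by Fin d × Fin d, and then ⟪ M , X ⟫ is ⟨ M , X ⟩.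
    pullback-SDP : ∀ {d} → SDPFormulation G₂ d → SDPFormulation G₁ d
    pullback-SDP {d} F = record
      { k = k
      ; 𝒜 = 𝒜
      ; b = b
      ; Xˢ = λ s₁ → curry (pullback-point K (λ s → uncurry (Xˢ s)) s₁)
      ; Xˢ-psd = λ s₁ → PSD-lincomb G₁ (as s₁) α≥0 (λ p → Xˢ-psd (sol p))
      ; Xˢ-feasible = λ s₁ i → pullback-point-≡ K (λ s → Xˢ-feasible s i) s₁
      ; w₀ = pullback-offset w₀
      ; W = λ f₁ hf₁ → curry (pullback-gradient K W′ f₁ hf₁)
      ; w-val = pullback-val K w₀ W′ w-val
      ; w-bound = λ f₁ hf₁ X X-psd X-feasible →
          pullback-Bounded K w₀ W′ (λ f hf → w-bound f hf X X-psd X-feasible) f₁ hf₁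
      }
      where
      open SDPFormulation F
      K = Fin-summation d ⊗ Fin-summation d
      W′ : (f : P₂.Inst) → InFS G₂ f → Summation.Vector K
      W′ f hf = uncurry (W f hf)

proposition4p2 : (ℝ : CompleteOrderedField) → let open Defs.Over ℝ in
    {P₁ P₂ : Problem} (G₁ : Guarantees P₁) (G₂ : Guarantees P₂) →
    Reduction G₁ G₂ → fc-≤ G₁ G₂ × fc₊-≤ G₁ G₂
proposition4p2 ℝ G₁ G₂ red =
  (λ m F → m , ℕ-≤-refl , pullback-LP F) , (λ d F → d , ℕ-≤-refl , pullback-SDP F)
  where open Pullback ℝ red
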